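{- Let $c,h\in\omega^\omega$, let $\langle I_n\mid n<\omega\rangle$ be the interval partition of $\omega$ into consecutive intervals with $|I_n|=h(n)$, and define $g_{c,h}\in\omega^\omega$ by $g_{c,h}(k):=\lfloor\log_2 c(n)\rfloor$ whenever $k\in I_n$. If $c(i)\ge 2$ and $h(i)\ge 1$ for all but finitely many $i$, $f\in\omega^\omega$ is increasing and $g_{c,h}\gg f$, then $\mathbf{Cv}(\mathcal{I}_f)\preceq_T\mathbf{aLc}(c,h)^\perp$. In particular, $\operatorname{cov}(\mathcal{I}_f)\le\mathfrak{c}^\exists_{c,h}$ and $\mathfrak{v}^\exists_{c,h}\le\operatorname{non}(\mathcal{I}_f)$.
   Context: Natural numbers are identified with $\{0,\dots,n-1\}$. $x\le^*y$ means $x(i)\le y(i)$ for all but finitely many $i$; $\mathrm{pow}_m(i)=i^m$; $g\gg f$ (equivalently $f\ll g$) means $f\circ\mathrm{pow}_m\le^*g$ for every $m<\omega$. Yorioka ideals: for $\sigma\in(2^{<\omega})^\omega$, $[\sigma]_\infty:=\bigcap_m\bigcup_{i\ge m}\{x\in2^\omega\mid\sigma(i)\subseteq x\}$, $\mathrm{ht}_\sigma(i)=|\sigma(i)|$; $\mathcal{J}_g:=\{X\subseteq2^\omega\mid\exists\sigma: X\subseteq[\sigma]_\infty,\ \mathrm{ht}_\sigma=g\}$; for increasing $f$, $\mathcal{I}_f:=\bigcup_{g\gg f}\mathcal{J}_g$. $\operatorname{cov}(\mathcal{I}_f)$ is the least size of a subfamily of $\mathcal{I}_f$ covering $2^\omega$;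 $\operatorname{non}(\mathcal{I}_f)$ the least size of a subset of $2^\omega$ not in $\mathcal{I}_f$. $\mathbf{Cv}(\mathcal{I}_f):=\langle 2^\omega,\mathcal{I}_f,\in\rangle$. Relational systems $\mathbf{R}=\langle X,Y,\sqsubset\rangle$; dual $\mathbf{R}^\perp=\langle Y,X,\not\sqsupset\rangle$ with $y\not\sqsupset x$ iff $\neg(x\sqsubset y)$; $\mathbf{R}\preceq_T\mathbf{R}'=\langle X',Y',\sqsubset'\rangle$ iff there are $F:X\to X'$, $G:Y'\to Y$ with $F(x)\sqsubset'y'\Rightarrow x\sqsubset G(y')$. For $h\in\omega^\omega$: $\prod c=\prod_i c(i)$, $\mathcal{S}(c,h)=\prod_i[c(i)]^{\le h(i)}$; $y\notin^\infty\varphi$ iff $y(i)\notin\varphi(i)$ for almost all $i$. $\mathbf{aLc}(c,h):=\langle\mathcal{S}(c,h),\prod c,R\rangle$, $\varphi R y$ iff $y\notin^\infty\varphi$. $\mathfrak{c}^\exists_{c,h}:=\min\{|R_0|\mid R_0\subseteq\mathcal{S}(c,h),\ \neg\exists y\in\prod c\ \forall\varphi\in R_0: y\notin^\infty\varphi\}$; $\mathfrak{v}^\exists_{c,h}:=\min\{|E|\mid E\subseteq\prod c,\ \forall\varphi\in\mathcal{S}(c,h)\ \exists y\in E: y\notin^\infty\varphi\}$. -}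

module Defs where

open import Level using (Level; _⊔_; 0ℓ) renaming (suc to lsuc)
open import Data.Nat using (ℕ; zero; suc; _+_; _^_; _≤_; _<_)
open import Data.Nat.Logarithm using (⌊log₂_⌋)
open import Data.Bool using (Bool)
open import Data.List using (List; []; _∷_; length)
open import Data.Fin using (Fin)
open import Data.Fin.Subset using (Subset; _∈_; ∣_∣)
open import Data.Product using (Σ; ∃; _×_; _,_; proj₁)
open import Data.Unit using (⊤)
open import Relation.Nullary using (¬_)
open import Relation.Binary.PropositionalEquality using (_≡_)
open import Relation.Unary using (Pred)
open import Function using (_∘_)

Cantor : Set
Cantor = ℕ → Bool

_≺_ : List Bool → Cantor → Set
[] ≺ x = ⊤
(b ∷ s) ≺ x = (b ≡ x 0) × (s ≺ (x ∘ suc))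

InfOften : (ℕ → List Bool) → Cantor → Set
InfOften σ x = ∀ m → ∃ λ i → m ≤ i × σ i ≺ x

Eventually : (ℕ → Set) → Set
Eventually P = ∃ λ N → ∀ i → N ≤ i → P i

_≤*_ : (ℕ → ℕ) → (ℕ → ℕ) → Set
f ≤* g = Eventually (λ i → f i ≤ g i)

pow : ℕ → ℕ → ℕ
pow m i = i ^ m

_≪_ : (ℕ → ℕ) → (ℕ → ℕ) → Set
f ≪ g = ∀ m → (f ∘ pow m) ≤* g

Increasing : (ℕ → ℕ) → Set
Increasing f = ∀ i → f i < f (suc i)

JIdeal : (ℕ → ℕ) → Pred Cantor 0ℓ → Set
JIdeal g X = ∃ λ (σ : ℕ → List Bool) →
  (∀ i → length (σ i) ≡ g i) × (∀ x → X x → InfOften σ x)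

YoriokaIdeal : (ℕ → ℕ) → Pred Cantor 0ℓ → Set
YoriokaIdeal f X = ∃ λ (g : ℕ → ℕ) → (f ≪ g) × JIdeal g X

record RelSys (a b r : Level) : Set (lsuc (a ⊔ b ⊔ r)) where
  field
    X : Set a
    Y : Set b
    rel : X → Y → Set r

open RelSys public

_⊥ : ∀ {a b r} → RelSys a b r → RelSys b a r
R ⊥ = record { X = Y R ; Y = X R ; rel = λ y x → ¬ (rel R x y) }

_⪯T_ : ∀ {a b r a' b' r'} → RelSys a b r → RelSys a' b' r' → Set (a ⊔ b ⊔ r ⊔ a' ⊔ b' ⊔ r')
R ⪯T R' = Σ (X R → X R') λ F → Σ (Y R' → Y R) λ G →
  ∀ x y' → rel R' (F x) y' → rel R x (G y')

Cv : (ℕ → ℕ) → RelSys 0ℓ (lsuc 0ℓ) 0ℓ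
Cv f = record
  { X = Cantor
  ; Y = Σ (Pred Cantor 0ℓ) (YoriokaIdeal f)
  ; rel = λ x A → proj₁ A x }

Prod : (ℕ → ℕ) → Set
Prod c = (i : ℕ) → Fin (c i)

Slaloms : (ℕ → ℕ) → (ℕ → ℕ) → Set
Slaloms c h = Σ ((i : ℕ) → Subset (c i)) λ φ → ∀ i → ∣ φ i ∣ ≤ h i

_∉∞_ : ∀ {c h} → Prod c → Slaloms c h → Set
y ∉∞ (φ , _) = Eventually (λ i → ¬ (y i ∈ φ i))

aLc : (ℕ → ℕ) → (ℕ → ℕ) → RelSys 0ℓ 0ℓ 0ℓ
aLc c h = record { X = Slaloms c h ; Y = Prod c ; rel = λ φ y → y ∉∞ φ }

start : (ℕ → ℕ) → ℕ → ℕ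
start h zero = 0
start h (suc n) = start h n + h n

IsGch : (ℕ → ℕ) → (ℕ → ℕ) → (ℕ → ℕ) → Set
IsGch c h g = ∀ n k → start h n ≤ k → k < start h (suc n) → g k ≡ ⌊log₂ c n ⌋

-- Write L(n) = ⌊log₂ c(n)⌋, so 2^{L(n)} ≤ c(n).  The Tukey maps are:
--   F : 2^ω → ∏c,   F(x)(n) = the number whose binary digits (least
--       significant first) are x(0), …, x(L(n)-1);  it is < c(n).
--   G : S(c,h) → I_f,  G(φ) = [σ_φ]_∞, where the interval I_n has room for
--       the at most h(n) elements of φ(n): the y ∈ φ(n) of rank r inside φ(n)
--       occupies the slot min I_n + r, and σ_φ there is the L(n)-digit binary
--       expansion of y (all other slots get zeros).  Since g = L(n) on I_n,
--       σ_φ has height g, so [σ_φ]_∞ ∈ J_g ⊆ I_f.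
-- If F(x)(n) ∈ φ(n) then σ_φ is an initial segment of x at the slot of F(x)(n);
-- if this happens for infinitely many n (the negation of F(x) ∉^∞ φ, read
-- classically) the slots tend to infinity, so x ∈ [σ_φ]_∞.
module Submission where

open import Defs
open import Level using (0ℓ)
open import Data.Nat using (ℕ; _≤_)
open import Axiom.ExcludedMiddle using (ExcludedMiddle)

open import Data.Nat using (zero; suc; _+_; _*_; _^_; _<_; z≤n; s≤s; ⌊_/2⌋; _≤′_; ≤′-refl; ≤′-step)
open import Data.Nat.Properties
open import Data.Nat.Logarithm using (⌊log₂_⌋)
open import Data.Nat.Logarithm.Core using (⌊log2⌋)
open import Induction.WellFounded using (Acc; acc)
open import Data.Bool using (Bool; true; false)
open import Data.List using (List; []; _∷_; length; replicate)
open import Data.List.Properties using (length-replicate)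
open import Data.Vec using (_∷_; here; there)
open import Data.Fin using (Fin; zero; suc; toℕ; fromℕ<)
open import Data.Fin.Properties using (toℕ-fromℕ<)
open import Data.Fin.Subset using (Subset; _∈_; ∣_∣)
open import Data.Product using (Σ; ∃; _×_; _,_; proj₁; proj₂)
open import Data.Unit using (tt)
open import Data.Empty using (⊥-elim)
open import Relation.Nullary using (¬_; Dec; yes; no)
open import Relation.Binary using (tri<; tri≈; tri>)
open import Relation.Binary.PropositionalEquality
open import Function using (_∘_)

bitValue : Bool → ℕ
bitValue true = 1
bitValue false = 0

double : ℕ → ℕ
double zero = zero
double (suc v) = suc (suc (double v))

value : ℕ → Cantor → ℕ
value zero x = 0
value (suc L) x = bitValue (x 0) + double (value L (x ∘ suc))

isOdd : ℕ → Bool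
isOdd zero = false
isOdd (suc zero) = true
isOdd (suc (suc n)) = isOdd n

digits : ℕ → ℕ → List Bool
digits zero m = []
digits (suc L) m = isOdd m ∷ digits L ⌊ m /2⌋

length-digits : ∀ L m → length (digits L m) ≡ L
length-digits zero m = refl
length-digits (suc L) m = cong suc (length-digits L ⌊ m /2⌋)

isOdd-bit+double : ∀ b v → isOdd (bitValue b + double v) ≡ b
isOdd-bit+double true zero = refl
isOdd-bit+double true (suc v) = isOdd-bit+double true v
isOdd-bit+double false zero = refl
isOdd-bit+double false (suc v) = isOdd-bit+double false v

half-bit+double : ∀ b v → ⌊ bitValue b + double v /2⌋ ≡ v
half-bit+double true zero = refl
half-bit+double true (suc v) = cong suc (half-bit+double true v)
half-bit+double false zero = refl
half-bit+double false (suc v) = cong suc (half-bit+double false v)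

digits-value : ∀ L x → digits L (value L x) ≺ x
digits-value zero x = tt
digits-value (suc L) x =
  isOdd-bit+double (x 0) v ,
  subst (λ m → digits L m ≺ (x ∘ suc)) (sym (half-bit+double (x 0) v))
        (digits-value L (x ∘ suc))
  where v = value L (x ∘ suc)

bit+double<double : ∀ b {v p} → v < p → bitValue b + double v < double p
bit+double<double true {zero} {suc p} _ = s≤s (s≤s z≤n)
bit+double<double false {zero} {suc p} _ = s≤s z≤n
bit+double<double b {suc v} {suc p} (s≤s v<p) =
  subst (_< double (suc p)) (sym (+-suc (bitValue b) (suc (double v))))
        (s≤s (subst (_< suc (double p)) (sym (+-suc (bitValue b) (double v)))
                    (s≤s (bit+double<double b v<p))))

double≡2* : ∀ p → double p ≡ 2 * p
double≡2* zero = refl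
double≡2* (suc p) = cong suc (trans (cong suc (double≡2* p)) (sym (+-suc p (p + 0))))

value<2^ : ∀ L x → value L x < 2 ^ L
value<2^ zero x = s≤s z≤n
value<2^ (suc L) x =
  subst (value (suc L) x <_) (double≡2* (2 ^ L))
        (bit+double<double (x 0) (value<2^ L (x ∘ suc)))

double-half≤ : ∀ n → 2 * ⌊ n /2⌋ ≤ n
double-half≤ zero = z≤n
double-half≤ (suc zero) = z≤n
double-half≤ (suc (suc n)) =
  subst (_≤ 2 + n) (sym (*-suc 2 ⌊ n /2⌋)) (s≤s (s≤s (double-half≤ n)))

-- By the recursion defining ⌊log2⌋: 2^{1+⌊log2⌋(1+⌊n/2⌋)} ≤ 2(1+⌊n/2⌋) ≤ n+2.
2^⌊log2⌋≤ : ∀ m (rec : Acc _<_ m) → 1 ≤ m → 2 ^ ⌊log2⌋ m rec ≤ m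
2^⌊log2⌋≤ (suc zero) _ _ = ≤-refl
2^⌊log2⌋≤ (suc (suc n)) (acc rs) _ = begin
  2 * 2 ^ ⌊log2⌋ (suc ⌊ n /2⌋) _  ≤⟨ *-monoʳ-≤ 2 (2^⌊log2⌋≤ (suc ⌊ n /2⌋) _ (s≤s z≤n)) ⟩
  2 * suc ⌊ n /2⌋                 ≡⟨ *-suc 2 ⌊ n /2⌋ ⟩
  2 + 2 * ⌊ n /2⌋                 ≤⟨ +-monoʳ-≤ 2 (double-half≤ n) ⟩
  2 + n                           ∎
  where open ≤-Reasoning

-- The same bound for the library's ⌊log₂_⌋, which is ⌊log2⌋ at <-wellFounded.
2^⌊log₂⌋≤ : ∀ m → 1 ≤ m → 2 ^ ⌊log₂ m ⌋ ≤ m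
2^⌊log₂⌋≤ m = 2^⌊log2⌋≤ m _

rank : ∀ {m} → Subset m → Fin m → ℕ
rank (b ∷ p) zero = 0
rank (b ∷ p) (suc i) = bitValue b + rank p i

rank<∣p∣ : ∀ {m} (p : Subset m) {i} → i ∈ p → rank p i < ∣ p ∣
rank<∣p∣ (true ∷ p) here = s≤s z≤n
rank<∣p∣ (true ∷ p) (there i∈p) = s≤s (rank<∣p∣ p i∈p)
rank<∣p∣ (false ∷ p) (there i∈p) = rank<∣p∣ p i∈p

rank-injective : ∀ {m} (p : Subset m) {i j} → i ∈ p → j ∈ p → rank p i ≡ rank p j → i ≡ j
rank-injective (b ∷ p) {zero} {zero} _ _ _ = refl
rank-injective (true ∷ p) {zero} {suc j} _ _ ()
rank-injective (true ∷ p) {suc i} {zero} _ _ ()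
rank-injective (true ∷ p) (there i∈p) (there j∈p) e = cong suc (rank-injective p i∈p j∈p (suc-injective e))
rank-injective (false ∷ p) (there i∈p) (there j∈p) e = cong suc (rank-injective p i∈p j∈p e)

module Intervals (h : ℕ → ℕ) where

  start-mono : ∀ {a b} → a ≤ b → start h a ≤ start h b
  start-mono a≤b = go (≤⇒≤′ a≤b)
    where
    go : ∀ {a b} → a ≤′ b → start h a ≤ start h b
    go ≤′-refl = ≤-refl
    go (≤′-step a≤′b) = ≤-trans (go a≤′b) (m≤m+n _ _)

  interval-unique : ∀ {n n' k} → start h n ≤ k → k < start h (suc n) →
                    start h n' ≤ k → k < start h (suc n') → n ≡ n'
  interval-unique {n} {n'} n≤k k<n n'≤k k<n' with <-cmp n n'
  ... | tri< n<n' _ _ = ⊥-elim (<⇒≱ (<-≤-trans k<n (start-mono n<n')) n'≤k)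
  ... | tri≈ _ n≡n' _ = n≡n'
  ... | tri> _ _ n'<n = ⊥-elim (<⇒≱ (<-≤-trans k<n' (start-mono n'<n)) n≤k)

  start-unbounded : ∀ N → (∀ i → N ≤ i → 1 ≤ h i) → ∀ j → j ≤ start h (N + j)
  start-unbounded N nonempty zero = z≤n
  start-unbounded N nonempty (suc j) = begin
    suc j                       ≡⟨ +-comm 1 j ⟩
    j + 1                       ≤⟨ +-mono-≤ (start-unbounded N nonempty j) (nonempty (N + j) (m≤m+n N j)) ⟩
    start h (suc (N + j))       ≡⟨ cong (start h) (sym (+-suc N j)) ⟩
    start h (N + suc j)         ∎
    where open ≤-Reasoning hiding (start)

unboundedly-often : ExcludedMiddle 0ℓ → (P : ℕ → Set) →
                    ¬ Eventually (λ i → ¬ P i) → ∀ m → ∃ λ n → m ≤ n × P n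
unboundedly-often em P notEventually m with em {∃ λ n → m ≤ n × P n}
... | yes witness = witness
... | no none = ⊥-elim (notEventually (m , λ i m≤i Pi → none (i , m≤i , Pi)))

module TukeyMaps (em : ExcludedMiddle 0ℓ) (c h g : ℕ → ℕ) (c≥1 : ∀ n → 1 ≤ c n)
                 (g≡gch : IsGch c h g) where
  open Intervals h

  width : ℕ → ℕ
  width n = ⌊log₂ c n ⌋

  code<c : ∀ x n → value (width n) x < c n
  code<c x n = <-≤-trans (value<2^ (width n) x) (2^⌊log₂⌋≤ (c n) (c≥1 n))

  F : Cantor → Prod c
  F x n = fromℕ< (code<c x n)

  slot : Slaloms c h → (n : ℕ) → Fin (c n) → ℕ
  slot φ n y = start h n + rank (proj₁ φ n) y

  -- Since |φ(n)| ≤ h(n) = |I_n|, these slots lie inside I_n …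
  slot<next : ∀ φ n {y} → y ∈ proj₁ φ n → slot φ n y < start h (suc n)
  slot<next φ n y∈φn = +-monoʳ-< (start h n) (<-≤-trans (rank<∣p∣ (proj₁ φ n) y∈φn) (proj₂ φ n))

  slot-injective : ∀ φ {n n' y y'} → y ∈ proj₁ φ n → y' ∈ proj₁ φ n' →
                   slot φ n y ≡ slot φ n' y' →
                   _≡_ {A = Σ ℕ (Fin ∘ c)} (n , y) (n' , y')
  slot-injective φ {n} {n'} {y} {y'} y∈φn y'∈φn' same
    with interval-unique {n} {n'} (m≤m+n _ _) (slot<next φ n y∈φn)
                         (subst (start h n' ≤_) (sym same) (m≤m+n _ _))
                         (subst (_< start h (suc n')) (sym same) (slot<next φ n' y'∈φn'))
  ... | refl = cong (n ,_) (rank-injective (proj₁ φ n) y∈φn y'∈φn' (+-cancelˡ-≡ (start h n) _ _ same))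

  Occupied : Slaloms c h → ℕ → Set
  Occupied φ k = Σ ℕ λ n → Σ (Fin (c n)) λ y → y ∈ proj₁ φ n × slot φ n y ≡ k

  label : ∀ φ k → Dec (Occupied φ k) → List Bool
  label φ k (yes (n , y , _)) = digits (g k) (toℕ y)
  label φ k (no _) = replicate (g k) false

  σ : Slaloms c h → ℕ → List Bool
  σ φ k = label φ k em

  length-label : ∀ φ k d → length (label φ k d) ≡ g k
  length-label φ k (yes (n , y , _)) = length-digits (g k) (toℕ y)
  length-label φ k (no _) = length-replicate (g k)

  G : (f : ℕ → ℕ) → f ≪ g → Slaloms c h → Σ (Cantor → Set) (YoriokaIdeal f)
  G f f≪g φ = InfOften (σ φ) , g , f≪g , σ φ , (λ k → length-label φ k em) , (λ x x∈ → x∈)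

  label-at-hit : ∀ x φ n → F x n ∈ proj₁ φ n →
                 (d : Dec (Occupied φ (slot φ n (F x n)))) → label φ (slot φ n (F x n)) d ≺ x
  label-at-hit x φ n hit (no unoccupied) = ⊥-elim (unoccupied (n , F x n , hit , refl))
  label-at-hit x φ n hit (yes (n' , y' , y'∈φn' , same)) with slot-injective φ y'∈φn' hit same
  ... | refl = subst₂ (λ L m → digits L m ≺ x)
                      (sym (g≡gch n _ (m≤m+n _ _) (slot<next φ n hit)))
                      (sym (toℕ-fromℕ< (code<c x n)))
                      (digits-value (width n) x)

  hits-give-slots : Eventually (λ i → 1 ≤ h i) → ∀ x φ → ¬ (F x ∉∞ φ) → InfOften (σ φ) x
  hits-give-slots (N , nonempty) x φ notAvoided m
    with unboundedly-often em (λ n → F x n ∈ proj₁ φ n) notAvoided (N + m)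
  ... | n , N+m≤n , hit = slot φ n (F x n) , m≤slot , label-at-hit x φ n hit em
    where
    m≤slot : m ≤ slot φ n (F x n)
    m≤slot = ≤-trans (start-unbounded N nonempty m) (≤-trans (start-mono N+m≤n) (m≤m+n _ _))

-- The theorem.

lemma2p4 : ExcludedMiddle 0ℓ →
    (c h f g : ℕ → ℕ) →
    (∀ i → 1 ≤ c i) →
    Eventually (λ i → 2 ≤ c i) →
    Eventually (λ i → 1 ≤ h i) →
    Increasing f →
    IsGch c h g →
    f ≪ g →
    Cv f ⪯T (aLc c h ⊥)
lemma2p4 em c h f g c≥1 _ h≥1 _ g≡gch f≪g = F , G f f≪g , hits-give-slots h≥1
  where open TukeyMaps em c h g c≥1 g≡gch
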